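{- Let $b\ge 2$ be an integer and $g=2$. Suppose that $(d_1,d_2,l,m,n)$, with integers $1\le d_1,d_2\le g-1$, $n\ge0$, $l,m\ge1$, is a solution of one of the equations $$(b\pm1)b^n\pm1=d_1\frac{g^l-1}{g-1}+d_2\frac{g^m-1}{g-1}\qquad\text{or}\qquad (b\pm1)b^n\pm1=d_1\frac{g^l-1}{g-1}-d_2\frac{g^m-1}{g-1}$$ (any choice of the signs). Then $n=0$ and $b=(2^l-1)\pm(2^m-1)\pm1\pm1$ for some choice of signs. -}

module Defs where

open import Data.Nat using (ℕ; _^_; _∸_)
open import Data.Nat.DivMod using (_/_)
open import Data.Integer using (ℤ; +_; _+_; _-_)
open import Data.Sign using (Sign)

g : ℕ
g = 2

-- (g^k - 1)/(g - 1), as an integer  (exact division since g - 1 = 1)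
rep : ℕ → ℤ
rep k = + ((g ^ k ∸ 1) / (g ∸ 1))

infixl 6 _⟨_⟩_
_⟨_⟩_ : ℤ → Sign → ℤ → ℤ
x ⟨ Sign.+ ⟩ y = x + y
x ⟨ Sign.- ⟩ y = x - y

-- Only g = 2 is allowed, so d₁ = d₂ = 1 and the right-hand side is 2^l - 1 ± (2^m - 1), which is
-- always even. For n ≥ 1 the left-hand side (b ± 1) b^n ± 1 is odd, because one of b ± 1 and b^n
-- is even. Hence n = 0, and then the equation can be solved for b.
module Submission where

open import Defs
open import Data.Nat.Base as ℕ using (ℕ; _≤_; _∸_; _^_; zero; suc) hiding (module ℕ)
import Data.Nat.Properties as ℕ
open import Data.Nat.DivMod using (n/1≡n)
open import Data.Nat.Divisibility using (∣1⇒≡1)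
open import Data.Integer using (ℤ; +_; _*_; _+_; _-_)
open import Data.Integer.Properties using (pos-+; pos-*; *-identityˡ; *-identityʳ)
open import Data.Integer.Divisibility.Signed
  using (_∣_; ∣-refl; ∣⇒∣ᵤ; ∣m∣n⇒∣m+n; ∣m∣n⇒∣m-n; ∣m+n∣m⇒∣n; ∣m⇒∣m*n; ∣n⇒∣m*n)
open import Data.Integer.Tactic.RingSolver using (solve-∀)
open import Data.Sign using (Sign; opposite)
open import Data.Product using (_×_; ∃-syntax; _,_)
open import Data.Sum using (_⊎_; inj₁; inj₂)
open import Data.Empty using (⊥; ⊥-elim)
open import Relation.Binary.PropositionalEquality
open ≡-Reasoning

Even : ℤ → Set
Even x = + 2 ∣ x

Odd : ℤ → Set
Odd x = Even (x + + 1)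

even⇒¬odd : ∀ {x} → Even x → Odd x → ⊥
even⇒¬odd 2∣x 2∣x+1 with ∣1⇒≡1 (∣⇒∣ᵤ (∣m+n∣m⇒∣n 2∣x+1 2∣x))
... | ()

even-⟨⟩ : ∀ {x y} → Even x → Even y → ∀ s → Even (x ⟨ s ⟩ y)
even-⟨⟩ 2∣x 2∣y Sign.+ = ∣m∣n⇒∣m+n 2∣x 2∣y
even-⟨⟩ 2∣x 2∣y Sign.- = ∣m∣n⇒∣m-n 2∣x 2∣y

odd-⟨⟩-odd : ∀ {x y} → Odd x → Odd y → ∀ s → Even (x ⟨ s ⟩ y)
odd-⟨⟩-odd {x} {y} ox oy Sign.+ =
  subst Even (plus x y) (∣m∣n⇒∣m-n (even-⟨⟩ ox oy Sign.+) ∣-refl)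
  where plus : ∀ x y → x + + 1 + (y + + 1) - + 2 ≡ x + y
        plus = solve-∀
odd-⟨⟩-odd {x} {y} ox oy Sign.- = subst Even (minus x y) (even-⟨⟩ ox oy Sign.-)
  where minus : ∀ x y → x + + 1 - (y + + 1) ≡ x - y
        minus = solve-∀

even-⟨⟩-1 : ∀ {x} → Even x → ∀ s → Odd (x ⟨ s ⟩ + 1)
even-⟨⟩-1 {x} 2∣x Sign.+ = subst Even (plus x) (∣m∣n⇒∣m+n 2∣x ∣-refl)
  where plus : ∀ x → x + + 2 ≡ x + + 1 + + 1
        plus = solve-∀
even-⟨⟩-1 {x} 2∣x Sign.- = subst Even (minus x) 2∣x
  where minus : ∀ x → x ≡ x - + 1 + + 1
        minus = solve-∀

odd-⟨⟩-1 : ∀ {x} → Odd x → ∀ s → Even (x ⟨ s ⟩ + 1)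
odd-⟨⟩-1 ox Sign.+ = ox
odd-⟨⟩-1 {x} ox Sign.- = subst Even (minus x) (∣m∣n⇒∣m-n ox ∣-refl)
  where minus : ∀ x → x + + 1 - + 2 ≡ x - + 1
        minus = solve-∀

pos-suc : ∀ n → + suc n ≡ + n + + 1
pos-suc n = trans (cong +_ (ℕ.+-comm 1 n)) (pos-+ n 1)

even⊎odd : ∀ n → Even (+ n) ⊎ Odd (+ n)
even⊎odd zero = inj₁ (∣m⇒∣m*n (+ 0) ∣-refl)
even⊎odd (suc n) with even⊎odd n
... | inj₁ en = inj₂ (subst Odd (sym (pos-suc n)) (even-⟨⟩-1 en Sign.+))
... | inj₂ on = inj₁ (subst Even (sym (pos-suc n)) on)

odd-rep : ∀ {k} → 1 ≤ k → Odd (rep k)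
odd-rep {suc k} _ = subst Even (sym rep+1≡2^[1+k]) (∣m⇒∣m*n (+ (2 ^ k)) ∣-refl)
  where
  rep+1≡2^[1+k] : rep (suc k) + + 1 ≡ + 2 * + (2 ^ k)
  rep+1≡2^[1+k] = begin
    rep (suc k) + + 1          ≡⟨ cong (λ a → + a + + 1) (n/1≡n (2 ^ suc k ∸ 1)) ⟩
    + (2 ^ suc k ∸ 1) + + 1    ≡⟨ pos-+ (2 ^ suc k ∸ 1) 1 ⟨
    + (2 ^ suc k ∸ 1 ℕ.+ 1)    ≡⟨ cong +_ (ℕ.m∸n+n≡m (ℕ.m^n>0 2 (suc k))) ⟩
    + (2 ^ suc k)              ≡⟨ pos-* 2 (2 ^ k) ⟩
    + 2 * + (2 ^ k)            ∎

even-rep-⟨⟩-rep : ∀ {l m} → 1 ≤ l → 1 ≤ m → ∀ s → Even (rep l ⟨ s ⟩ rep m)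
even-rep-⟨⟩-rep 1≤l 1≤m = odd-⟨⟩-odd (odd-rep 1≤l) (odd-rep 1≤m)

even-[b±1]*b^[1+n] : ∀ b n s → Even ((+ b ⟨ s ⟩ + 1) * + (b ^ suc n))
even-[b±1]*b^[1+n] b n s with even⊎odd b
... | inj₁ even-b = ∣n⇒∣m*n (+ b ⟨ s ⟩ + 1)
                      (subst Even (sym (pos-* b (b ^ n))) (∣m⇒∣m*n (+ (b ^ n)) even-b))
... | inj₂ odd-b  = ∣m⇒∣m*n (+ (b ^ suc n)) (odd-⟨⟩-1 odd-b s)

⟨⟩-cancel : ∀ x y s → x ⟨ s ⟩ y ⟨ opposite s ⟩ y ≡ x
⟨⟩-cancel x y Sign.+ = plus-minus x y
  where plus-minus : ∀ x y → x + y - y ≡ x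
        plus-minus = solve-∀
⟨⟩-cancel x y Sign.- = minus-plus x y
  where minus-plus : ∀ x y → x - y + y ≡ x
        minus-plus = solve-∀

solve-[x±1]*1±1 : ∀ {x y} s₁ s₂ → (x ⟨ s₁ ⟩ + 1) * + 1 ⟨ s₂ ⟩ + 1 ≡ y →
                  x ≡ y ⟨ opposite s₂ ⟩ + 1 ⟨ opposite s₁ ⟩ + 1
solve-[x±1]*1±1 {x} s₁ s₂ refl = begin
  x                                      ≡⟨ ⟨⟩-cancel x (+ 1) s₁ ⟨
  x ⟨ s₁ ⟩ + 1 ⟨ opposite s₁ ⟩ + 1       ≡⟨ cong (_⟨ opposite s₁ ⟩ + 1) (*-identityʳ _) ⟨
  (x ⟨ s₁ ⟩ + 1) * + 1 ⟨ opposite s₁ ⟩ + 1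
    ≡⟨ cong (_⟨ opposite s₁ ⟩ + 1) (⟨⟩-cancel _ (+ 1) s₂) ⟨
  (x ⟨ s₁ ⟩ + 1) * + 1 ⟨ s₂ ⟩ + 1 ⟨ opposite s₂ ⟩ + 1 ⟨ opposite s₁ ⟩ + 1 ∎

lemma4 : (b d₁ d₂ l m n : ℕ) → 2 ≤ b → 1 ≤ d₁ → d₁ ≤ g ∸ 1 → 1 ≤ d₂ → d₂ ≤ g ∸ 1 → 1 ≤ l → 1 ≤ m →
    (s₁ s₂ s₃ : Sign) →
    (+ b ⟨ s₁ ⟩ + 1) * + (b ^ n) ⟨ s₂ ⟩ + 1 ≡ (+ d₁ * rep l) ⟨ s₃ ⟩ (+ d₂ * rep m) →
    n ≡ 0 × ∃[ t₁ ] ∃[ t₂ ] ∃[ t₃ ] + b ≡ rep l ⟨ t₁ ⟩ rep m ⟨ t₂ ⟩ + 1 ⟨ t₃ ⟩ + 1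
lemma4 b d₁ d₂ l m n _ 1≤d₁ d₁≤1 1≤d₂ d₂≤1 1≤l 1≤m s₁ s₂ s₃ eq
  with refl ← ℕ.≤-antisym d₁≤1 1≤d₁ | refl ← ℕ.≤-antisym d₂≤1 1≤d₂
  with n | trans eq (cong₂ (_⟨ s₃ ⟩_) (*-identityˡ (rep l)) (*-identityˡ (rep m)))
... | zero  | eq′ = refl , s₃ , opposite s₂ , opposite s₁ , solve-[x±1]*1±1 s₁ s₂ eq′
... | suc n | eq′ = ⊥-elim (even⇒¬odd (even-rep-⟨⟩-rep 1≤l 1≤m s₃) (subst Odd eq′ odd-lhs))
  where
  odd-lhs : Odd ((+ b ⟨ s₁ ⟩ + 1) * + (b ^ suc n) ⟨ s₂ ⟩ + 1)
  odd-lhs = even-⟨⟩-1 (even-[b±1]*b^[1+n] b n s₁) s₂
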